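{- Let $\Gamma$ be a connected graph with vertices $x,x_1,\dots,x_{n-1}$ ($n\ge 2$) such that $x_1\cdots x_{n-1}$ is an induced path, and let $v\in\mathbb{F}_2^{n-1}$ have $i$-th entry $1$ iff $x$ is adjacent to $x_i$. Then $$A(\Gamma)=\sum_{\substack{u\in U_{n-1}\\ u^\top v=1}}2^{z(u)+1},\qquad B(\Gamma)=\sum_{\substack{u\in U_{n-1}\\ u^\top v=0}}2^{z(u)},$$ where $z(u)$ is the number of zero entries of $u$.
   Context: All matrices are over $\mathbb{F}_2$. A symmetric matrix $M\in M_n(\mathbb{F}_2)$ represents $\Gamma$ (vertex order $x,x_1,\dots,x_{n-1}$) if for $i\ne j$ its $(i,j)$-entry is $1$ exactly when the corresponding vertices are adjacent and $0$ otherwise, with arbitrary diagonal. $A(\Gamma)$ (resp. $B(\Gamma)$) is the number of matrices representing $\Gamma$ in this order that have rank $n$ (resp. rank $n-1$) and whose lower-right $(n-1)\times(n-1)$ submatrix (rows and columns of $x_1,\dots,x_{n-1}$) has rank $n-2$. $U_k$ is the set of vectors in $\mathbb{F}_2^k$ with first and last entries equal to $1$ and no two consecutive entries both $0$. -}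

module Defs where

open import Data.Bool using (Bool; true; false; _∧_; _∨_; _xor_; not; if_then_else_)
open import Data.Nat using (ℕ; zero; suc; _+_; _^_; _⊔_)
open import Data.Fin using (Fin; zero; suc; toℕ; _≟_)
open import Data.List using (List; []; _∷_; map; filter; foldr; concatMap)
open import Data.Vec using (Vec; []; _∷_; lookup; tail; head; last; allFin)
open import Data.Product using (_×_)
open import Data.Sum using (_⊎_)
open import Relation.Nullary using (¬_)
open import Relation.Nullary.Decidable using (⌊_⌋)
open import Relation.Binary.PropositionalEquality using (_≡_)
open import Function using (_⇔_)

-- Vectors over F₂ are Vec Bool k (true = 1, false = 0); addition is xor.

allᵇ : {A : Set} → (A → Bool) → List A → Bool
allᵇ p [] = true
allᵇ p (a ∷ as) = p a ∧ allᵇ p as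

allVecs : (k : ℕ) → List (Vec Bool k)
allVecs zero = [] ∷ []
allVecs (suc k) = concatMap (λ v → (false ∷ v) ∷ (true ∷ v) ∷ []) (allVecs k)

zeroVec : (k : ℕ) → Vec Bool k
zeroVec zero = []
zeroVec (suc k) = false ∷ zeroVec k

_⊕_ : {k : ℕ} → Vec Bool k → Vec Bool k → Vec Bool k
[] ⊕ [] = []
(a ∷ u) ⊕ (b ∷ w) = (a xor b) ∷ (u ⊕ w)

isZero : {k : ℕ} → Vec Bool k → Bool
isZero [] = true
isZero (a ∷ u) = not a ∧ isZero u

ones : {k : ℕ} → Vec Bool k → ℕ
ones [] = 0
ones (true ∷ u) = suc (ones u)
ones (false ∷ u) = ones u

zeros : {k : ℕ} → Vec Bool k → ℕ
zeros [] = 0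
zeros (true ∷ u) = zeros u
zeros (false ∷ u) = suc (zeros u)

dot : {k : ℕ} → Vec Bool k → Vec Bool k → Bool
dot [] [] = false
dot (a ∷ u) (b ∷ w) = (a ∧ b) xor dot u w

_⊆ᵇ_ : {k : ℕ} → Vec Bool k → Vec Bool k → Bool
[] ⊆ᵇ [] = true
(a ∷ u) ⊆ᵇ (b ∷ w) = (not a ∨ b) ∧ (u ⊆ᵇ w)

Matrix : ℕ → ℕ → Set
Matrix m n = Vec (Vec Bool n) m

entry : {m n : ℕ} → Matrix m n → Fin m → Fin n → Bool
entry M i j = lookup (lookup M i) j

sumRows : {m n : ℕ} → Matrix m n → Vec Bool m → Vec Bool n
sumRows {n = n} [] [] = zeroVec n
sumRows (r ∷ M) (true ∷ s) = r ⊕ sumRows M s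
sumRows (r ∷ M) (false ∷ s) = sumRows M s

independentRows : {m n : ℕ} → Matrix m n → Vec Bool m → Bool
independentRows {m} M s =
  allᵇ (λ T → not (T ⊆ᵇ s ∧ isZero (sumRows M T)) ∨ isZero T) (allVecs m)

rank : {m n : ℕ} → Matrix m n → ℕ
rank {m} M = foldr _⊔_ 0 (map ones (filter (λ s → independentRows M s ≟ᵇ true) (allVecs m)))
  where
  open import Data.Bool.Properties using () renaming (_≟_ to _≟ᵇ_)

lowerRight : {n : ℕ} → Matrix (suc n) (suc n) → Matrix n n
lowerRight M = Data.Vec.map tail (tail M)

record Graph (n : ℕ) : Set where
  field
    adj    : Fin n → Fin n → Bool
    sym    : ∀ i j → adj i j ≡ adj j i
    irrefl : ∀ i → adj i i ≡ false
open Graph public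

data Reach {n : ℕ} (G : Graph n) : Fin n → Fin n → Set where
  here : ∀ {a} → Reach G a a
  step : ∀ {a b c} → adj G a b ≡ true → Reach G b c → Reach G a c

Connected : {n : ℕ} → Graph n → Set
Connected G = ∀ a b → Reach G a b

represents : {n : ℕ} → Matrix n n → Graph n → Bool
represents {n} M G =
  allᵇ (λ i → allᵇ (λ j → ⌊ i ≟ j ⌋ ∨ (entry M i j ≟ᵇ adj G i j))
                 (Data.Vec.toList (allFin n)))
      (Data.Vec.toList (allFin n))
  where
  _≟ᵇ_ : Bool → Bool → Bool
  a ≟ᵇ b = not (a xor b)

allMatrices : (m n : ℕ) → List (Matrix m n)
allMatrices zero n = [] ∷ []
allMatrices (suc m) n = concatMap (λ r → map (r ∷_) (allMatrices m n)) (allVecs n)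

count : {A : Set} → (A → Bool) → List A → ℕ
count p [] = 0
count p (a ∷ as) = if p a then suc (count p as) else count p as

-- vertex order x = zero, x_{i+1} = suc i ; n = suc (suc k), so n-1 = suc k, n-2 = k
-- A(Γ): representing matrices of rank n whose lower-right block has rank n-2
A : {k : ℕ} → Graph (suc (suc k)) → ℕ
A {k} G = count (λ M → represents M G ∧ (rank M ≡ᵇ suc (suc k)) ∧ (rank (lowerRight M) ≡ᵇ k))
                (allMatrices (suc (suc k)) (suc (suc k)))
  where open import Data.Nat using (_≡ᵇ_)

B : {k : ℕ} → Graph (suc (suc k)) → ℕ
B {k} G = count (λ M → represents M G ∧ (rank M ≡ᵇ suc k) ∧ (rank (lowerRight M) ≡ᵇ k))
                (allMatrices (suc (suc k)) (suc (suc k)))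
  where open import Data.Nat using (_≡ᵇ_)

noTwoZeros : {k : ℕ} → Vec Bool k → Bool
noTwoZeros [] = true
noTwoZeros (a ∷ []) = true
noTwoZeros (a ∷ b ∷ u) = (a ∨ b) ∧ noTwoZeros (b ∷ u)

inU : {k : ℕ} → Vec Bool (suc k) → Bool
inU u = head u ∧ last u ∧ noTwoZeros u

InducedPath : {k : ℕ} → Graph (suc (suc k)) → Set
InducedPath {k} G = ∀ (i j : Fin (suc k)) →
  (adj G (suc i) (suc j) ≡ true) ⇔ (suc (toℕ i) ≡ toℕ j ⊎ suc (toℕ j) ≡ toℕ i)

adjVec : {k : ℕ} → Graph (suc (suc k)) → Vec Bool (suc k)
adjVec {k} G = Data.Vec.map (λ i → adj G zero (suc i)) (allFin (suc k))

-- A matrix representing Γ is determined by its diagonal (d₀, d₁, …, dₘ), m = n − 1. Its first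
-- row is (d₀, v) and, since x₁ ⋯ xₘ is an induced path, its lower-right block is the tridiagonal
-- matrix T(d) with diagonal d and ones beside it. The recurrence tᵢ₊₁ = tᵢ₋₁ + dᵢtᵢ started at
-- (t₀, t₁) = (0, 1) shows that T(d) has corank at most one, and that it is singular exactly when
-- it returns tₘ₊₁ = 0; the kernel vector u = (t₁, …, tₘ) then lies in Uₘ. A discrete Green's
-- identity shows that T(d) w = v is solvable iff u·v = 0. Hence the bordered matrix has rank n
-- iff u·v = 1, and otherwise rank n − 1 or at most n − 2 according as d₀ + w·v is 1 or 0: so A(Γ)
-- counts the pairs (d₀, d) with T(d) singular and u·v = 1, and B(Γ) the d with T(d) singular and
-- u·v = 0 (for exactly one d₀). Finally every u ∈ Uₘ is the kernel vector of exactly 2^z(u)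
-- diagonals, as dᵢ is forced where uᵢ = 1 and free where uᵢ = 0.

module Submission where

open import Defs renaming (sym to adj-sym)
open import Algebra.Properties.CommutativeSemigroup using (interchange)
open import Data.Bool using (Bool; true; false; _∧_; _∨_; _xor_; not; if_then_else_)
open import Data.Bool.Properties
  using (∨-identityʳ; ∨-zeroʳ; ∧-identityʳ; ∧-zeroʳ; xor-identityʳ; xor-assoc; xor-same; xor-∧-commutativeRing)
  renaming (_≟_ to _≟ᵇ_)
open import Data.List using (List; []; _∷_; map; filter; foldr; concatMap; _++_)
open import Data.List.Membership.Propositional using (_∈_)
open import Data.List.Relation.Unary.Any using (here; there)
open import Data.List.Properties using (map-cong)
open import Data.Maybe using (Maybe; just; nothing)
open import Data.Empty using (⊥-elim)
open import Data.Sum using (_⊎_; inj₁; inj₂)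
open import Data.Unit using (⊤)
open import Data.Nat using (ℕ; zero; suc; pred; _+_; _*_; _^_; _⊔_; _≤_; _<_; z≤n; s≤s; _≤?_; _≡ᵇ_)
open import Data.Nat.ListAction using (sum)
open import Data.Nat.Properties
  using (+-identityʳ; +-assoc; +-comm; +-commutativeSemigroup; *-identityˡ; *-identityʳ; *-assoc; *-zeroʳ;
         *-distribˡ-+; ≤-trans; ≤-antisym; ≤-pred;
         m≤m⊔n; m≤n⊔m; ⊔-lub; ≤∧≢⇒<; m≤n⇒m≤1+n; ≰⇒>; <⇒≢; n<1+n; 1+n≰n)
  renaming (_≟_ to _≟ℕ_)
open import Data.Vec using (Vec; []; _∷_; zipWith; last; lookup; tabulate; toList; allFin; tail)
open import Data.Vec.Properties
  using (∷-injective; ∷-injectiveʳ; lookup∘tabulate; tabulate∘lookup; tabulate-cong; lookup-map; lookup-allFin; lookup-zipWith)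
open import Data.Fin using (Fin; zero; suc; toℕ) renaming (_≟_ to _≟ᶠ_)
open import Data.Product using (_×_; _,_; proj₁; proj₂)
open import Function using (_∘_; id)
open import Level using (0ℓ)
open import Relation.Nullary using (yes; no)
open import Relation.Nullary.Decidable using (⌊_⌋; does; dec-true; dec-false; does-⇔; _⊎-dec_)
open import Relation.Binary.PropositionalEquality
open import Tactic.RingSolver using (solve-∀)
open import Tactic.RingSolver.Core.AlmostCommutativeRing using (AlmostCommutativeRing; fromCommutativeRing)

private
  variable
    m n : ℕ
    X Y : Set

𝔽₂ : AlmostCommutativeRing 0ℓ 0ℓ
𝔽₂ = fromCommutativeRing xor-∧-commutativeRing isFalse
  where
  isFalse : ∀ x → Maybe (false ≡ x)
  isFalse false = just refl
  isFalse true  = nothing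

⊕-identityˡ : (x : Vec Bool n) → zeroVec n ⊕ x ≡ x
⊕-identityˡ []      = refl
⊕-identityˡ (a ∷ x) = cong (a ∷_) (⊕-identityˡ x)

⊕-identityʳ : (x : Vec Bool n) → x ⊕ zeroVec n ≡ x
⊕-identityʳ []      = refl
⊕-identityʳ (a ∷ x) = cong₂ _∷_ (xor-identityʳ a) (⊕-identityʳ x)

⊕-assoc : (x y z : Vec Bool n) → (x ⊕ y) ⊕ z ≡ x ⊕ (y ⊕ z)
⊕-assoc []      []      []      = refl
⊕-assoc (a ∷ x) (b ∷ y) (c ∷ z) = cong₂ _∷_ (xor-assoc a b c) (⊕-assoc x y z)

⊕-self : (x : Vec Bool n) → x ⊕ x ≡ zeroVec n
⊕-self []      = refl
⊕-self (a ∷ x) = cong₂ _∷_ (xor-same a) (⊕-self x)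

⊕≡0⇒≡ : (x y : Vec Bool n) → x ⊕ y ≡ zeroVec n → x ≡ y
⊕≡0⇒≡ x y x⊕y≡0 = begin
  x                 ≡⟨ ⊕-identityʳ x ⟨
  x ⊕ zeroVec _     ≡⟨ cong (x ⊕_) (⊕-self y) ⟨
  x ⊕ (y ⊕ y)       ≡⟨ ⊕-assoc x y y ⟨
  (x ⊕ y) ⊕ y       ≡⟨ cong (_⊕ y) x⊕y≡0 ⟩
  zeroVec _ ⊕ y     ≡⟨ ⊕-identityˡ y ⟩
  y                 ∎
  where open ≡-Reasoning

isZero⇒≡0 : (x : Vec Bool n) → isZero x ≡ true → x ≡ zeroVec n
isZero⇒≡0 []          _  = refl
isZero⇒≡0 (false ∷ x) x0 = cong (false ∷_) (isZero⇒≡0 x x0)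

isZero-zeroVec : ∀ n → isZero (zeroVec n) ≡ true
isZero-zeroVec zero    = refl
isZero-zeroVec (suc n) = isZero-zeroVec n

dot-zeroʳ : (x : Vec Bool n) → dot x (zeroVec n) ≡ false
dot-zeroʳ []      = refl
dot-zeroʳ (a ∷ x) rewrite ∧-zeroʳ a = dot-zeroʳ x

∑ : {X : Set} → List X → (X → ℕ) → ℕ
∑ xs f = sum (map f xs)

infixl 5 _when_
_when_ : ℕ → Bool → ℕ
k when b = if b then k else 0

∑-cong : {f g : X → ℕ} → (∀ x → f x ≡ g x) → ∀ xs → ∑ xs f ≡ ∑ xs g
∑-cong f≗g xs = cong sum (map-cong f≗g xs)

∑-zero : (xs : List X) → ∑ xs (λ _ → 0) ≡ 0
∑-zero []       = refl
∑-zero (x ∷ xs) = ∑-zero xs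

∑-++ : (f : X → ℕ) (xs ys : List X) → ∑ (xs ++ ys) f ≡ ∑ xs f + ∑ ys f
∑-++ f []       ys = refl
∑-++ f (x ∷ xs) ys = trans (cong (f x +_) (∑-++ f xs ys)) (sym (+-assoc (f x) _ _))

∑-+ : (f g : X → ℕ) (xs : List X) → ∑ xs (λ x → f x + g x) ≡ ∑ xs f + ∑ xs g
∑-+ f g []       = refl
∑-+ f g (x ∷ xs) = trans (cong (f x + g x +_) (∑-+ f g xs))
                        (interchange +-commutativeSemigroup (f x) (g x) (∑ xs f) (∑ xs g))

∑-*ˡ : (k : ℕ) (f : X → ℕ) (xs : List X) → ∑ xs (λ x → k * f x) ≡ k * ∑ xs f
∑-*ˡ k f []       = sym (*-zeroʳ k)
∑-*ˡ k f (x ∷ xs) = trans (cong (k * f x +_) (∑-*ˡ k f xs)) (sym (*-distribˡ-+ k (f x) (∑ xs f)))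

∑-when : (f : X → ℕ) (b : Bool) (xs : List X) → ∑ xs (λ x → f x when b) ≡ ∑ xs f when b
∑-when f true  xs = refl
∑-when f false xs = ∑-zero xs

count≡∑ : (p : X → Bool) (xs : List X) → count p xs ≡ ∑ xs (λ x → 1 when p x)
count≡∑ p []       = refl
count≡∑ p (x ∷ xs) with p x
... | true  = cong suc (count≡∑ p xs)
... | false = count≡∑ p xs

sum-filter≡∑ : (p : X → Bool) (w : X → ℕ) (xs : List X) →
  sum (map w (filter (λ x → p x ≟ᵇ true) xs)) ≡ ∑ xs (λ x → w x when p x)
sum-filter≡∑ p w []       = refl
sum-filter≡∑ p w (x ∷ xs) with p x
... | true  = cong (w x +_) (sum-filter≡∑ p w xs)
... | false = sum-filter≡∑ p w xs

∑-concatMap : (f : Y → ℕ) (g : X → List Y) (xs : List X) →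
  ∑ (concatMap g xs) f ≡ ∑ xs (λ x → ∑ (g x) f)
∑-concatMap f g []       = refl
∑-concatMap f g (x ∷ xs) = trans (∑-++ f (g x) _) (cong (∑ (g x) f +_) (∑-concatMap f g xs))

∑-map : (f : Y → ℕ) (g : X → Y) (xs : List X) → ∑ (map g xs) f ≡ ∑ xs (λ x → f (g x))
∑-map f g []       = refl
∑-map f g (x ∷ xs) = cong (f (g x) +_) (∑-map f g xs)

∑-allVecs : (f : Vec Bool (suc m) → ℕ) →
  ∑ (allVecs (suc m)) f ≡ ∑ (allVecs m) (λ x → f (false ∷ x)) + ∑ (allVecs m) (λ x → f (true ∷ x))
∑-allVecs {m} f = begin
  ∑ (allVecs (suc m)) f
    ≡⟨ ∑-concatMap f _ (allVecs m) ⟩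
  ∑ (allVecs m) (λ x → f (false ∷ x) + (f (true ∷ x) + 0))
    ≡⟨ ∑-cong (λ x → cong (f (false ∷ x) +_) (+-identityʳ _)) (allVecs m) ⟩
  ∑ (allVecs m) (λ x → f (false ∷ x) + f (true ∷ x))
    ≡⟨ ∑-+ _ _ (allVecs m) ⟩
  ∑ (allVecs m) (λ x → f (false ∷ x)) + ∑ (allVecs m) (λ x → f (true ∷ x))
    ∎
  where open ≡-Reasoning

-- Rank over 𝔽₂

infix 4 _∈ker_
_∈ker_ : Vec Bool m → Matrix m n → Set
_∈ker_ {n = n} T M = sumRows M T ≡ zeroVec n

∈-allVecs : (v : Vec Bool m) → v ∈ allVecs m
∈-allVecs []      = here refl
∈-allVecs (b ∷ v) = ∈-pairs b (∈-allVecs v)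
  where
  ∈-pairs : ∀ {x : Vec Bool m} b {xs} → x ∈ xs → (b ∷ x) ∈ concatMap (λ v → (false ∷ v) ∷ (true ∷ v) ∷ []) xs
  ∈-pairs false (here refl) = here refl
  ∈-pairs true  (here refl) = there (here refl)
  ∈-pairs b     (there x∈)  = there (there (∈-pairs b x∈))

∧≡true⇒ : ∀ a b → a ∧ b ≡ true → a ≡ true × b ≡ true
∧≡true⇒ true true _ = refl , refl

allᵇ-∈ : (p : X → Bool) {x : X} (xs : List X) → allᵇ p xs ≡ true → x ∈ xs → p x ≡ true
allᵇ-∈ p (y ∷ xs) all-p (here refl) = proj₁ (∧≡true⇒ _ _ all-p)
allᵇ-∈ p (y ∷ xs) all-p (there x∈)  = allᵇ-∈ p xs (proj₂ (∧≡true⇒ _ _ all-p)) x∈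

allᵇ-intro : (p : X → Bool) (xs : List X) → (∀ x → p x ≡ true) → allᵇ p xs ≡ true
allᵇ-intro p []       _   = refl
allᵇ-intro p (y ∷ xs) p-true rewrite p-true y = allᵇ-intro p xs p-true

module _ (P : X → Bool) (f : X → ℕ) where

  maxOver : List X → ℕ
  maxOver xs = foldr _⊔_ 0 (map f (filter (λ x → P x ≟ᵇ true) xs))

  ≤-maxOver : ∀ {x} xs → x ∈ xs → P x ≡ true → f x ≤ maxOver xs
  ≤-maxOver (y ∷ xs) (here refl) Px rewrite Px = m≤m⊔n (f y) _
  ≤-maxOver (y ∷ xs) (there x∈)  Px with P y
  ... | true  = ≤-trans (≤-maxOver xs x∈ Px) (m≤n⊔m (f y) _)
  ... | false = ≤-maxOver xs x∈ Px

  maxOver-≤ : ∀ c xs → (∀ x → P x ≡ true → f x ≤ c) → maxOver xs ≤ c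
  maxOver-≤ c []       _     = z≤n
  maxOver-≤ c (y ∷ xs) bound with P y in Py
  ... | true  = ⊔-lub (bound y Py) (maxOver-≤ c xs bound)
  ... | false = maxOver-≤ c xs bound

independent⇒ : (M : Matrix m n) (s T : Vec Bool m) → independentRows M s ≡ true →
  (T ⊆ᵇ s) ≡ true → T ∈ker M → T ≡ zeroVec m
independent⇒ {m} {n} M s T indep T⊆s T∈ker
  with allᵇ-∈ _ (allVecs m) indep (∈-allVecs T)
... | T-ok rewrite T⊆s | T∈ker | isZero-zeroVec n = isZero⇒≡0 T T-ok

independent⇐ : (M : Matrix m n) (s : Vec Bool m) →
  (∀ T → (T ⊆ᵇ s) ≡ true → T ∈ker M → T ≡ zeroVec m) → independentRows M s ≡ true
independent⇐ {m} M s only-trivial = allᵇ-intro _ (allVecs m) trivial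
  where
  trivial : ∀ T → (not ((T ⊆ᵇ s) ∧ isZero (sumRows M T)) ∨ isZero T) ≡ true
  trivial T with T ⊆ᵇ s in T⊆s | isZero (sumRows M T) in MT≡0
  ... | true  | true  rewrite only-trivial T T⊆s (isZero⇒≡0 _ MT≡0) = isZero-zeroVec m
  ... | true  | false = refl
  ... | false | _     = refl

rank-≥ : (M : Matrix m n) (s : Vec Bool m) →
  (∀ T → (T ⊆ᵇ s) ≡ true → T ∈ker M → T ≡ zeroVec m) → ones s ≤ rank M
rank-≥ {m} M s only-trivial =
  ≤-maxOver (independentRows M) ones (allVecs m) (∈-allVecs s) (independent⇐ M s only-trivial)

rank-≤ : (M : Matrix m n) (c : ℕ) → (∀ s → independentRows M s ≡ true → ones s ≤ c) → rank M ≤ c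
rank-≤ {m} M c bound = maxOver-≤ (independentRows M) ones c (allVecs m) bound

allTrue : ∀ n → Vec Bool n
allTrue zero    = []
allTrue (suc n) = true ∷ allTrue n

ones-allTrue : ∀ n → ones (allTrue n) ≡ n
ones-allTrue zero    = refl
ones-allTrue (suc n) = cong suc (ones-allTrue n)

ones-≤ : (s : Vec Bool n) → ones s ≤ n
ones-≤ []          = z≤n
ones-≤ (true ∷ s)  = s≤s (ones-≤ s)
ones-≤ (false ∷ s) = m≤n⇒m≤1+n (ones-≤ s)

ones≡n⇒allTrue : (s : Vec Bool n) → ones s ≡ n → s ≡ allTrue n
ones≡n⇒allTrue []          _    = refl
ones≡n⇒allTrue (true ∷ s)  full = cong (true ∷_) (ones≡n⇒allTrue s (cong pred full))
ones≡n⇒allTrue (false ∷ s) full = ⊥-elim (1+n≰n (subst (_≤ _) full (ones-≤ s)))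

⊆ᵇ-allTrue : (T : Vec Bool n) → (T ⊆ᵇ allTrue n) ≡ true
⊆ᵇ-allTrue []          = refl
⊆ᵇ-allTrue (true ∷ T)  = ⊆ᵇ-allTrue T
⊆ᵇ-allTrue (false ∷ T) = ⊆ᵇ-allTrue T

rank-full : (M : Matrix m n) → (∀ T → T ∈ker M → T ≡ zeroVec m) → rank M ≡ m
rank-full {m} M ker-trivial = ≤-antisym (rank-≤ M m (λ s _ → ones-≤ s))
  (subst (_≤ rank M) (ones-allTrue m) (rank-≥ M (allTrue m) (λ T _ → ker-trivial T)))

rank-≤-pred : (M : Matrix (suc m) n) (K : Vec Bool (suc m)) → K ∈ker M → K ≢ zeroVec (suc m) → rank M ≤ m
rank-≤-pred {m} M K K∈ker K≢0 = rank-≤ M m λ s indep →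
  ≤-pred (≤∧≢⇒< (ones-≤ s) λ full →
    K≢0 (independent⇒ M s K indep
          (subst (λ s → (K ⊆ᵇ s) ≡ true) (sym (ones≡n⇒allTrue s full)) (⊆ᵇ-allTrue K)) K∈ker))

xor-interchange : ∀ a b c d → (a xor b) xor (c xor d) ≡ (a xor c) xor (b xor d)
xor-interchange = solve-∀ 𝔽₂

⊕-interchange : (x y z w : Vec Bool n) → (x ⊕ y) ⊕ (z ⊕ w) ≡ (x ⊕ z) ⊕ (y ⊕ w)
⊕-interchange []      []      []      []      = refl
⊕-interchange (a ∷ x) (b ∷ y) (c ∷ z) (d ∷ w) = cong₂ _∷_ (xor-interchange a b c d) (⊕-interchange x y z w)

sumRows-⊕ : (M : Matrix m n) (T T′ : Vec Bool m) → sumRows M (T ⊕ T′) ≡ sumRows M T ⊕ sumRows M T′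
sumRows-⊕ []      []          []           = sym (⊕-identityˡ _)
sumRows-⊕ (r ∷ M) (false ∷ T) (false ∷ T′) = sumRows-⊕ M T T′
sumRows-⊕ (r ∷ M) (true ∷ T)  (false ∷ T′) = trans (cong (r ⊕_) (sumRows-⊕ M T T′)) (sym (⊕-assoc r _ _))
sumRows-⊕ (r ∷ M) (false ∷ T) (true ∷ T′)  = begin
  r ⊕ sumRows M (T ⊕ T′)           ≡⟨ cong (r ⊕_) (sumRows-⊕ M T T′) ⟩
  r ⊕ (sumRows M T ⊕ sumRows M T′) ≡⟨ cong (_⊕ _) (⊕-identityˡ r) ⟨
  (zeroVec _ ⊕ r) ⊕ (sumRows M T ⊕ sumRows M T′) ≡⟨ ⊕-interchange _ r _ _ ⟩
  (zeroVec _ ⊕ sumRows M T) ⊕ (r ⊕ sumRows M T′) ≡⟨ cong (_⊕ _) (⊕-identityˡ _) ⟩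
  sumRows M T ⊕ (r ⊕ sumRows M T′) ∎
  where open ≡-Reasoning
sumRows-⊕ (r ∷ M) (true ∷ T)  (true ∷ T′)  = begin
  sumRows M (T ⊕ T′)                 ≡⟨ sumRows-⊕ M T T′ ⟩
  sumRows M T ⊕ sumRows M T′          ≡⟨ ⊕-identityˡ _ ⟨
  zeroVec _ ⊕ (sumRows M T ⊕ sumRows M T′) ≡⟨ cong (_⊕ _) (⊕-self r) ⟨
  (r ⊕ r) ⊕ (sumRows M T ⊕ sumRows M T′) ≡⟨ ⊕-interchange r r _ _ ⟩
  (r ⊕ sumRows M T) ⊕ (r ⊕ sumRows M T′) ∎
  where open ≡-Reasoning

AtMostOneFalse : Vec Bool n → Set
AtMostOneFalse []          = ⊤
AtMostOneFalse (true ∷ s)  = AtMostOneFalse s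
AtMostOneFalse (false ∷ s) = s ≡ allTrue _

atMostOneFalse : (s : Vec Bool n) → n ≤ suc (ones s) → AtMostOneFalse s
atMostOneFalse []          _           = _
atMostOneFalse (true ∷ s)  (s≤s n≤1+s) = atMostOneFalse s n≤1+s
atMostOneFalse (false ∷ s) (s≤s n≤s)   = ones≡n⇒allTrue s (≤-antisym (ones-≤ s) n≤s)

-- If two vectors both have a 1 at the omitted row, their sum has a 0 there.
one-of-three-⊆ᵇ : (s : Vec Bool n) → AtMostOneFalse s → (K₁ K₂ : Vec Bool n) →
  (K₁ ⊆ᵇ s) ≡ true ⊎ (K₂ ⊆ᵇ s) ≡ true ⊎ ((K₁ ⊕ K₂) ⊆ᵇ s) ≡ true
one-of-three-⊆ᵇ []          _    []         []         = inj₁ refl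
one-of-three-⊆ᵇ (true ∷ s)  omit (a ∷ K₁)   (b ∷ K₂)
  rewrite ∨-zeroʳ (not a) | ∨-zeroʳ (not b) | ∨-zeroʳ (not (a xor b)) = one-of-three-⊆ᵇ s omit K₁ K₂
one-of-three-⊆ᵇ (false ∷ s) refl (false ∷ K₁) _          = inj₁ (⊆ᵇ-allTrue K₁)
one-of-three-⊆ᵇ (false ∷ s) refl (true ∷ K₁)  (false ∷ K₂) = inj₂ (inj₁ (⊆ᵇ-allTrue K₂))
one-of-three-⊆ᵇ (false ∷ s) refl (true ∷ K₁)  (true ∷ K₂)  = inj₂ (inj₂ (⊆ᵇ-allTrue (K₁ ⊕ K₂)))

rank-≤-pred² : (M : Matrix (suc (suc m)) n) (K₁ K₂ : Vec Bool (suc (suc m))) → K₁ ∈ker M → K₂ ∈ker M →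
  K₁ ≢ zeroVec _ → K₂ ≢ zeroVec _ → K₁ ≢ K₂ → rank M ≤ m
rank-≤-pred² {m} {n} M K₁ K₂ K₁∈ker K₂∈ker K₁≢0 K₂≢0 K₁≢K₂ = rank-≤ M m bound
  where
  K₁⊕K₂∈ker : K₁ ⊕ K₂ ∈ker M
  K₁⊕K₂∈ker = trans (sumRows-⊕ M K₁ K₂) (trans (cong₂ _⊕_ K₁∈ker K₂∈ker) (⊕-identityˡ (zeroVec n)))

  bound : ∀ s → independentRows M s ≡ true → ones s ≤ m
  bound s indep with ones s ≤? m
  ... | yes s≤m = s≤m
  ... | no  s≰m with one-of-three-⊆ᵇ s (atMostOneFalse s (s≤s (≰⇒> s≰m))) K₁ K₂
  ... | inj₁ K₁⊆s        = ⊥-elim (K₁≢0 (independent⇒ M s K₁ indep K₁⊆s K₁∈ker))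
  ... | inj₂ (inj₁ K₂⊆s) = ⊥-elim (K₂≢0 (independent⇒ M s K₂ indep K₂⊆s K₂∈ker))
  ... | inj₂ (inj₂ K⊆s)  =
    ⊥-elim (K₁≢K₂ (⊕≡0⇒≡ K₁ K₂ (independent⇒ M s (K₁ ⊕ K₂) indep K⊆s K₁⊕K₂∈ker)))

-- Tridiagonal matrices and the shooting method

head₀ : Vec Bool n → Bool
head₀ []      = false
head₀ (b ∷ _) = b

e₀ : ∀ n → Vec Bool n
e₀ zero    = []
e₀ (suc n) = true ∷ zeroVec n

dot-e₀ : (T : Vec Bool n) → dot T (e₀ n) ≡ head₀ T
dot-e₀ []      = refl
dot-e₀ (t ∷ T) rewrite dot-zeroʳ T | ∧-identityʳ t = xor-identityʳ t

-- the adjacency matrix of the path 1 − 2 − ⋯ − n with diagonal ds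
tridiagonal : Vec Bool n → Matrix n n
tridiagonal []       = []
tridiagonal (d ∷ ds) = (d ∷ e₀ _) ∷ zipWith _∷_ (e₀ _) (tridiagonal ds)

bordered : Bool → Vec Bool n → Vec Bool n → Matrix (suc n) (suc n)
bordered d₀ v ds = (d₀ ∷ v) ∷ zipWith _∷_ v (tridiagonal ds)

-- Entry i is tᵢ₋₁ + dᵢtᵢ + tᵢ₊₁, reading t₀ as p and tₙ₊₁ as 0.
triApply : Bool → Vec Bool n → Vec Bool n → Vec Bool n
triApply p []       []       = []
triApply p (d ∷ ds) (t ∷ ts) = (p xor ((d ∧ t) xor head₀ ts)) ∷ triApply t ds ts

sumRows-zipWith : (c : Vec Bool m) (R : Matrix m n) (T : Vec Bool m) →
  sumRows (zipWith _∷_ c R) T ≡ dot T c ∷ sumRows R T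
sumRows-zipWith []      []      []          = refl
sumRows-zipWith (x ∷ c) (r ∷ R) (true ∷ T)  rewrite sumRows-zipWith c R T = refl
sumRows-zipWith (x ∷ c) (r ∷ R) (false ∷ T) = sumRows-zipWith c R T

e₀-⊕-triApply : (ds T : Vec Bool n) → e₀ n ⊕ triApply false ds T ≡ triApply true ds T
e₀-⊕-triApply []       []      = refl
e₀-⊕-triApply (d ∷ ds) (t ∷ T) = cong (_ ∷_) (⊕-identityˡ _)

sumRows-tridiagonal : (ds T : Vec Bool n) → sumRows (tridiagonal ds) T ≡ triApply false ds T
sumRows-tridiagonal []       []          = refl
sumRows-tridiagonal (d ∷ ds) (true ∷ T)
  rewrite sumRows-zipWith (e₀ _) (tridiagonal ds) T | dot-e₀ T | ∧-identityʳ d | sumRows-tridiagonal ds T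
  = cong (_ ∷_) (e₀-⊕-triApply ds T)
sumRows-tridiagonal (d ∷ ds) (false ∷ T)
  rewrite sumRows-zipWith (e₀ _) (tridiagonal ds) T | dot-e₀ T | ∧-zeroʳ d | sumRows-tridiagonal ds T
  = refl

_·_ : Bool → Vec Bool n → Vec Bool n
true  · v = v
false · v = zeroVec _

sumRows-bordered : (d₀ : Bool) (v ds : Vec Bool n) (t₀ : Bool) (T : Vec Bool n) →
  sumRows (bordered d₀ v ds) (t₀ ∷ T) ≡ ((t₀ ∧ d₀) xor dot T v) ∷ ((t₀ · v) ⊕ triApply false ds T)
sumRows-bordered d₀ v ds true  T rewrite sumRows-zipWith v (tridiagonal ds) T | sumRows-tridiagonal ds T = refl
sumRows-bordered d₀ v ds false T rewrite sumRows-zipWith v (tridiagonal ds) T | sumRows-tridiagonal ds T =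
  cong (dot T v ∷_) (sym (⊕-identityˡ (triApply false ds T)))

next : Bool → Bool → Bool → Bool → Bool
next a b d c = c xor (a xor (d ∧ b))

-- shoot a b ds cs solves triApply a ds t ≡ cs from the initial values t₀ = a, t₁ = b,
-- ignoring the last equation; overshoot is the value tₙ₊₁ that this forces and
-- penultimate is tₙ, so the last equation holds iff the overshoot is 0.
shoot : Bool → Bool → Vec Bool n → Vec Bool n → Vec Bool n
shoot a b []       []       = []
shoot a b (d ∷ ds) (c ∷ cs) = b ∷ shoot b (next a b d c) ds cs

overshoot : Bool → Bool → Vec Bool n → Vec Bool n → Bool
overshoot a b []       []       = b
overshoot a b (d ∷ ds) (c ∷ cs) = overshoot b (next a b d c) ds cs

penultimate : Bool → Bool → Vec Bool n → Vec Bool n → Bool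
penultimate a b []       []       = a
penultimate a b (d ∷ ds) (c ∷ cs) = penultimate b (next a b d c) ds cs

head₀-shoot : ∀ a b (ds cs : Vec Bool n) → overshoot a b ds cs ≡ false → head₀ (shoot a b ds cs) ≡ b
head₀-shoot a b []       []       b≡0 = sym b≡0
head₀-shoot a b (d ∷ ds) (c ∷ cs) _   = refl

row-next : ∀ a b d c → a xor ((d ∧ b) xor (c xor (a xor (d ∧ b)))) ≡ c
row-next = solve-∀ 𝔽₂

next-row : ∀ a b d h → h ≡ (a xor ((d ∧ b) xor h)) xor (a xor (d ∧ b))
next-row = solve-∀ 𝔽₂

shoot-solves : ∀ a b (ds cs : Vec Bool n) → overshoot a b ds cs ≡ false → triApply a ds (shoot a b ds cs) ≡ cs
shoot-solves a b []       []       _        = refl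
shoot-solves a b (d ∷ ds) (c ∷ cs) overshot
  rewrite head₀-shoot b (next a b d c) ds cs overshot =
  cong₂ _∷_ (row-next a b d c) (shoot-solves b (next a b d c) ds cs overshot)

solution-shoots : ∀ a (ds cs t : Vec Bool n) → triApply a ds t ≡ cs →
  t ≡ shoot a (head₀ t) ds cs × overshoot a (head₀ t) ds cs ≡ false
solution-shoots a []       []       []       _      = refl , refl
solution-shoots a (d ∷ ds) (c ∷ cs) (t ∷ ts) solves
  with ∷-injective solves
... | row , rest with solution-shoots t ds cs ts rest
... | ts-shot , no-overshoot =
  cong (t ∷_) (trans ts-shot (cong (λ h → shoot t h ds cs) h≡next)) ,
  subst (λ h → overshoot t h ds cs ≡ false) h≡next no-overshoot
  where
  h≡next : head₀ ts ≡ next a t d c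
  h≡next = trans (next-row a t d (head₀ ts)) (cong (_xor (a xor (d ∧ t))) row)

shoot-zero : (ds : Vec Bool n) → shoot false false ds (zeroVec n) ≡ zeroVec n
shoot-zero []       = refl
shoot-zero (d ∷ ds) rewrite ∧-zeroʳ d = cong (false ∷_) (shoot-zero ds)

wronskian-step : ∀ a b a′ b′ d c →
  (b ∧ (c xor (a′ xor (d ∧ b′)))) xor ((a xor (d ∧ b)) ∧ b′) ≡ ((a ∧ b′) xor (b ∧ a′)) xor (b ∧ c)
wronskian-step = solve-∀ 𝔽₂

-- The discrete Wronskian a b′ + b a′ of a homogeneous solution (a, b) and a solution
-- (a′, b′) of the system with right-hand side cs grows by bᵢcᵢ at each step (Green's identity).
wronskian : ∀ a b a′ b′ (ds cs : Vec Bool n) →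
  (penultimate a b ds (zeroVec n) ∧ overshoot a′ b′ ds cs) xor (overshoot a b ds (zeroVec n) ∧ penultimate a′ b′ ds cs)
    ≡ ((a ∧ b′) xor (b ∧ a′)) xor dot (shoot a b ds (zeroVec n)) cs
wronskian a b a′ b′ []       []       = sym (xor-identityʳ _)
wronskian a b a′ b′ (d ∷ ds) (c ∷ cs) = begin
  _ ≡⟨ wronskian b (next a b d false) b′ (next a′ b′ d c) ds cs ⟩
  ((b ∧ next a′ b′ d c) xor (next a b d false ∧ b′)) xor dot S cs
    ≡⟨ cong (_xor dot S cs) (wronskian-step a b a′ b′ d c) ⟩
  (((a ∧ b′) xor (b ∧ a′)) xor (b ∧ c)) xor dot S cs
    ≡⟨ xor-assoc ((a ∧ b′) xor (b ∧ a′)) (b ∧ c) (dot S cs) ⟩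
  ((a ∧ b′) xor (b ∧ a′)) xor ((b ∧ c) xor dot S cs) ∎
  where
  open ≡-Reasoning
  S = shoot b (next a b d false) ds (zeroVec _)

penultimate∨overshoot : ∀ a b (ds : Vec Bool n) → a ∨ b ≡ true →
  penultimate a b ds (zeroVec n) ∨ overshoot a b ds (zeroVec n) ≡ true
penultimate∨overshoot a b []       a∨b = a∨b
penultimate∨overshoot a b (d ∷ ds) a∨b = penultimate∨overshoot b (next a b d false) ds (nonvanishing a b d a∨b)
  where
  nonvanishing : ∀ a b d → a ∨ b ≡ true → b ∨ next a b d false ≡ true
  nonvanishing a     true  d     _ = refl
  nonvanishing true  false true  _ = refl
  nonvanishing true  false false _ = refl

kernelVec : Vec Bool n → Vec Bool n
kernelVec ds = shoot false true ds (zeroVec _)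

Singular : Vec Bool n → Set
Singular ds = overshoot false true ds (zeroVec _) ≡ false

singular : Vec Bool n → Bool
singular ds = not (overshoot false true ds (zeroVec _))

overshoot≡dot-kernelVec : (ds : Vec Bool n) → Singular ds → ∀ b cs →
  overshoot false b ds cs ≡ dot (kernelVec ds) cs
overshoot≡dot-kernelVec ds sing b cs
  with penultimate false true ds (zeroVec _) | wronskian false true false b ds cs | penultimate∨overshoot false true ds refl
... | true  | green | _ rewrite sing = trans (sym (xor-identityʳ _)) green
... | false | _     | pen∨over rewrite sing with pen∨over
... | ()

≡ᵇ-refl : ∀ n → (n ≡ᵇ n) ≡ true
≡ᵇ-refl n = dec-true (n ≟ℕ n) refl

≢⇒≡ᵇ-false : ∀ {m n} → m ≢ n → (m ≡ᵇ n) ≡ false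
≢⇒≡ᵇ-false {m} {n} = dec-false (m ≟ℕ n)

∈ker-tridiagonal : (ds T : Vec Bool n) → T ∈ker tridiagonal ds →
  T ≡ shoot false (head₀ T) ds (zeroVec n) × overshoot false (head₀ T) ds (zeroVec n) ≡ false
∈ker-tridiagonal ds T T∈ker = solution-shoots false ds (zeroVec _) T (trans (sym (sumRows-tridiagonal ds T)) T∈ker)

kernelVec∈ker : (ds : Vec Bool n) → Singular ds → kernelVec ds ∈ker tridiagonal ds
kernelVec∈ker ds sing = trans (sumRows-tridiagonal ds _) (shoot-solves false true ds (zeroVec _) sing)

kernelVec≢0 : (ds : Vec Bool (suc n)) → kernelVec ds ≢ zeroVec (suc n)
kernelVec≢0 (d ∷ ds) ()

rank-tridiagonal-singular : (ds : Vec Bool (suc n)) → Singular ds → rank (tridiagonal ds) ≡ n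
rank-tridiagonal-singular {n} ds sing = ≤-antisym
  (rank-≤-pred (tridiagonal ds) (kernelVec ds) (kernelVec∈ker ds sing) (kernelVec≢0 ds))
  (subst (_≤ rank (tridiagonal ds)) (ones-allTrue n) (rank-≥ (tridiagonal ds) (false ∷ allTrue n) trivial))
  where
  trivial : ∀ T → (T ⊆ᵇ (false ∷ allTrue n)) ≡ true → T ∈ker tridiagonal ds → T ≡ zeroVec (suc n)
  trivial (false ∷ T) _ T∈ker = trans (proj₁ (∈ker-tridiagonal ds _ T∈ker)) (shoot-zero ds)

rank-tridiagonal-regular : (ds : Vec Bool n) → overshoot false true ds (zeroVec n) ≡ true → rank (tridiagonal ds) ≡ n
rank-tridiagonal-regular ds regular = rank-full (tridiagonal ds) trivial
  where
  trivial : ∀ T → T ∈ker tridiagonal ds → T ≡ zeroVec _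
  trivial T T∈ker with head₀ T | ∈ker-tridiagonal ds T T∈ker
  ... | false | T≡0 , _    = trans T≡0 (shoot-zero ds)
  ... | true  | _ , sing with trans (sym regular) sing
  ... | ()

rank-tridiagonal≡ᵇ : (ds : Vec Bool (suc n)) → (rank (tridiagonal ds) ≡ᵇ n) ≡ singular ds
rank-tridiagonal≡ᵇ {n} ds with overshoot false true ds (zeroVec _) in over
... | false rewrite rank-tridiagonal-singular ds over = ≡ᵇ-refl n
... | true  rewrite rank-tridiagonal-regular ds over  = ≢⇒≡ᵇ-false (<⇒≢ (n<1+n n) ∘ sym)

∈ker-bordered⇒ : (d₀ : Bool) (v ds : Vec Bool n) (t₀ : Bool) (T : Vec Bool n) →
  (t₀ ∷ T) ∈ker bordered d₀ v ds → (t₀ ∧ d₀) xor dot T v ≡ false × triApply false ds T ≡ t₀ · v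
∈ker-bordered⇒ d₀ v ds t₀ T T∈ker with ∷-injective (trans (sym (sumRows-bordered d₀ v ds t₀ T)) T∈ker)
... | first , rest = first , sym (⊕≡0⇒≡ _ _ rest)

∈ker-bordered⇐ : (d₀ : Bool) (v ds : Vec Bool n) (t₀ : Bool) (T : Vec Bool n) →
  (t₀ ∧ d₀) xor dot T v ≡ false → triApply false ds T ≡ t₀ · v → (t₀ ∷ T) ∈ker bordered d₀ v ds
∈ker-bordered⇐ d₀ v ds t₀ T first rest =
  trans (sumRows-bordered d₀ v ds t₀ T) (cong₂ _∷_ first (trans (cong ((t₀ · v) ⊕_) rest) (⊕-self (t₀ · v))))

-- With u the kernel vector of the singular tridiagonal block and w the solution of its
-- system with right-hand side v, the corank of the bordered matrix is decided by u·v and d₀ + w·v.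
module _ {k : ℕ} (d₀ : Bool) (v ds : Vec Bool (suc k)) (sing : Singular ds) where

  private
    u w : Vec Bool (suc k)
    u = kernelVec ds
    w = shoot false false ds v

    u∈ker : dot u v ≡ false → (false ∷ u) ∈ker bordered d₀ v ds
    u∈ker u·v≡0 = ∈ker-bordered⇐ d₀ v ds false u u·v≡0 (shoot-solves false true ds (zeroVec _) sing)

    false∷u≢0 : false ∷ u ≢ zeroVec (suc (suc k))
    false∷u≢0 = kernelVec≢0 ds ∘ ∷-injectiveʳ

  rank-bordered-full : dot u v ≡ true → rank (bordered d₀ v ds) ≡ suc (suc k)
  rank-bordered-full u·v≡1 = rank-full (bordered d₀ v ds) trivial
    where
    trivial : ∀ T → T ∈ker bordered d₀ v ds → T ≡ zeroVec _
    trivial (false ∷ T) T∈ker with ∈ker-bordered⇒ d₀ v ds false T T∈ker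
    ... | T·v≡0 , solves with head₀ T | solution-shoots false ds (zeroVec _) T solves
    ... | false | T≡0 , _ = cong (false ∷_) (trans T≡0 (shoot-zero ds))
    ... | true  | T≡u , _ with trans (sym u·v≡1) (trans (cong (λ t → dot t v) (sym T≡u)) T·v≡0)
    ... | ()
    trivial (true ∷ T) T∈ker with ∈ker-bordered⇒ d₀ v ds true T T∈ker
    ... | _ , solves with solution-shoots false ds v T solves
    ... | _ , no-overshoot
      with trans (sym u·v≡1) (trans (sym (overshoot≡dot-kernelVec ds sing (head₀ T) v)) no-overshoot)
    ... | ()

  rank-bordered-corank1 : dot u v ≡ false → d₀ xor dot w v ≡ true → rank (bordered d₀ v ds) ≡ suc k
  rank-bordered-corank1 u·v≡0 d₀+w·v≡1 = ≤-antisym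
    (rank-≤-pred (bordered d₀ v ds) (false ∷ u) (u∈ker u·v≡0) false∷u≢0)
    (subst (_≤ rank (bordered d₀ v ds)) (cong suc (ones-allTrue k))
      (rank-≥ (bordered d₀ v ds) (true ∷ false ∷ allTrue k) trivial))
    where
    trivial : ∀ T → (T ⊆ᵇ (true ∷ false ∷ allTrue k)) ≡ true → T ∈ker bordered d₀ v ds → T ≡ zeroVec _
    trivial (false ∷ false ∷ T) _ T∈ker with ∈ker-bordered⇒ d₀ v ds false (false ∷ T) T∈ker
    ... | _ , solves = cong (false ∷_) (trans (proj₁ (solution-shoots false ds _ _ solves)) (shoot-zero ds))
    trivial (true ∷ false ∷ T) _ T∈ker with ∈ker-bordered⇒ d₀ v ds true (false ∷ T) T∈ker
    ... | d₀+T·v≡0 , solves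
      with trans (sym d₀+w·v≡1)
                 (trans (cong (λ t → d₀ xor dot t v) (sym (proj₁ (solution-shoots false ds v _ solves)))) d₀+T·v≡0)
    ... | ()

  rank-bordered-corank2 : dot u v ≡ false → d₀ xor dot w v ≡ false → rank (bordered d₀ v ds) ≤ k
  rank-bordered-corank2 u·v≡0 d₀+w·v≡0 =
    rank-≤-pred² (bordered d₀ v ds) (false ∷ u) (true ∷ w) (u∈ker u·v≡0) w∈ker false∷u≢0 (λ ()) (λ ())
    where
    w∈ker : (true ∷ w) ∈ker bordered d₀ v ds
    w∈ker = ∈ker-bordered⇐ d₀ v ds true w d₀+w·v≡0
      (shoot-solves false false ds v (trans (overshoot≡dot-kernelVec ds sing false v) u·v≡0))

module _ {k : ℕ} (d₀ : Bool) (v ds : Vec Bool (suc k)) where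

  private
    u w : Vec Bool (suc k)
    u = kernelVec ds
    w = shoot false false ds v

  full-rank-condition :
    ((rank (bordered d₀ v ds) ≡ᵇ suc (suc k)) ∧ (rank (tridiagonal ds) ≡ᵇ k)) ≡ singular ds ∧ dot u v
  full-rank-condition rewrite rank-tridiagonal≡ᵇ ds with overshoot false true ds (zeroVec _) in sing
  ... | true  = ∧-zeroʳ _
  ... | false with dot u v in u·v
  ... | true rewrite rank-bordered-full d₀ v ds sing u·v = trans (∧-identityʳ _) (≡ᵇ-refl (suc (suc k)))
  ... | false with d₀ xor dot w v in d₀+w·v
  ... | true rewrite rank-bordered-corank1 d₀ v ds sing u·v d₀+w·v =
    trans (∧-identityʳ _) (≢⇒≡ᵇ-false {suc k} {suc (suc k)} (<⇒≢ (n<1+n _)))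
  ... | false = trans (∧-identityʳ _)
    (≢⇒≡ᵇ-false {m = rank (bordered d₀ v ds)}
      (<⇒≢ (s≤s (m≤n⇒m≤1+n (rank-bordered-corank2 d₀ v ds sing u·v d₀+w·v)))))

  corank-one-condition :
    ((rank (bordered d₀ v ds) ≡ᵇ suc k) ∧ (rank (tridiagonal ds) ≡ᵇ k))
      ≡ singular ds ∧ (not (dot u v) ∧ (d₀ xor dot w v))
  corank-one-condition rewrite rank-tridiagonal≡ᵇ ds with overshoot false true ds (zeroVec _) in sing
  ... | true  = ∧-zeroʳ _
  ... | false with dot u v in u·v
  ... | true rewrite rank-bordered-full d₀ v ds sing u·v =
    trans (∧-identityʳ _) (≢⇒≡ᵇ-false {suc (suc k)} {suc k} (<⇒≢ (n<1+n _) ∘ sym))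
  ... | false with d₀ xor dot w v in d₀+w·v
  ... | true rewrite rank-bordered-corank1 d₀ v ds sing u·v d₀+w·v = trans (∧-identityʳ _) (≡ᵇ-refl (suc k))
  ... | false = trans (∧-identityʳ _)
    (≢⇒≡ᵇ-false {m = rank (bordered d₀ v ds)} (<⇒≢ (s≤s (rank-bordered-corank2 d₀ v ds sing u·v d₀+w·v))))

-- Counting singular tridiagonal matrices by their kernel vectors

-- x₁ = b, reading x₁ as 0 when x is empty
startsWith : Bool → Vec Bool n → Bool
startsWith b []      = not b
startsWith b (t ∷ _) = not (t xor b)

-- a, x₁, …, xₙ, 0 has no two consecutive zeros
noTwoZerosFrom : Bool → Vec Bool n → Bool
noTwoZerosFrom a []      = a
noTwoZerosFrom a (t ∷ x) = (a ∨ t) ∧ noTwoZerosFrom t x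

startsWith-false : (x : Vec Bool n) → startsWith false x ≡ not (startsWith true x)
startsWith-false []          = refl
startsWith-false (true ∷ x)  = refl
startsWith-false (false ∷ x) = refl

startsWith-noTwoZerosFrom-false : (x : Vec Bool n) → startsWith true x ∧ noTwoZerosFrom false x ≡ noTwoZerosFrom false x
startsWith-noTwoZerosFrom-false []          = refl
startsWith-noTwoZerosFrom-false (true ∷ x)  = refl
startsWith-noTwoZerosFrom-false (false ∷ x) = refl

when-split : ∀ k b c → k when c ≡ (k when (b ∧ c)) + (k when (not b ∧ c))
when-split k true  c = sym (+-identityʳ _)
when-split k false c = refl

when-*ˡ : ∀ j k c → j * k when c ≡ j * (k when c)
when-*ˡ j k true  = refl
when-*ˡ j k false = sym (*-zeroʳ j)

-- Fibres of the shooting map: dᵢ is forced where xᵢ = 1 and free where xᵢ = 0.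
∑-shoot : ∀ m a b (F : Vec Bool m → ℕ) → a ∨ b ≡ true →
  ∑ (allVecs m) (λ ds → F (shoot a b ds (zeroVec m)) when not (overshoot a b ds (zeroVec m)))
    ≡ ∑ (allVecs m) (λ x → 2 ^ zeros x * F x when (startsWith b x ∧ noTwoZerosFrom a x))
∑-shoot zero    true  false F _ = cong (_+ 0) (sym (*-identityˡ (F [])))
∑-shoot zero    a     true  F _ = refl
∑-shoot (suc m) a     true  F _ = begin
  _ ≡⟨ ∑-allVecs (λ ds → F (shoot a true ds (zeroVec _)) when not (overshoot a true ds (zeroVec _))) ⟩
  _ ≡⟨ cong₂ _+_ (∑-shoot m true (a xor false) (F ∘ (true ∷_)) refl)
                 (∑-shoot m true (a xor true) (F ∘ (true ∷_)) refl) ⟩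
  S (a xor false) + S (a xor true) ≡⟨ both-branches a ⟩
  S true + S false                 ≡⟨ ∑-+ _ _ (allVecs m) ⟨
  ∑ (allVecs m) (λ x → (W x when (startsWith true x ∧ P x)) + (W x when (startsWith false x ∧ P x)))
    ≡⟨ ∑-cong (λ x → trans (cong (λ s → (W x when (startsWith true x ∧ P x)) + (W x when (s ∧ P x))) (startsWith-false x))
                           (sym (when-split (W x) (startsWith true x) (P x)))) (allVecs m) ⟩
  ∑ (allVecs m) (λ x → W x when P x)
    ≡⟨ ∑-cong (λ x → cong (λ o → W x when (o ∧ P x)) (sym (∨-zeroʳ a))) (allVecs m) ⟩
  S₁      ≡⟨ cong (_+ S₁) (∑-zero (allVecs m)) ⟨
  _ ≡⟨ ∑-allVecs (λ x → 2 ^ zeros x * F x when (startsWith true x ∧ noTwoZerosFrom a x)) ⟨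
  _ ∎
  where
  open ≡-Reasoning
  W : Vec Bool m → ℕ
  W x = 2 ^ zeros x * F (true ∷ x)
  P : Vec Bool m → Bool
  P = noTwoZerosFrom true
  S : Bool → ℕ
  S c = ∑ (allVecs m) (λ x → W x when (startsWith c x ∧ P x))
  S₁ : ℕ
  S₁ = ∑ (allVecs m) (λ x → W x when ((a ∨ true) ∧ P x))
  both-branches : ∀ a → S (a xor false) + S (a xor true) ≡ S true + S false
  both-branches true  = refl
  both-branches false = +-comm (S false) (S true)
∑-shoot (suc m) true  false F _ = begin
  _ ≡⟨ ∑-allVecs (λ ds → F (shoot true false ds (zeroVec _)) when not (overshoot true false ds (zeroVec _))) ⟩
  _ ≡⟨ cong (λ s → s + s) (∑-shoot m false true (F ∘ (false ∷_)) refl) ⟩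
  S + S     ≡⟨ cong (S +_) (+-identityʳ S) ⟨
  2 * S     ≡⟨ ∑-*ˡ 2 _ (allVecs m) ⟨
  ∑ (allVecs m) (λ x → 2 * (2 ^ zeros x * F (false ∷ x) when (startsWith true x ∧ noTwoZerosFrom false x)))
    ≡⟨ ∑-cong (λ x → trans (sym (when-*ˡ 2 (2 ^ zeros x * F (false ∷ x)) (startsWith true x ∧ noTwoZerosFrom false x)))
                     (cong₂ _when_ (sym (*-assoc 2 (2 ^ zeros x) _)) (startsWith-noTwoZerosFrom-false x))) (allVecs m) ⟩
  S₂                ≡⟨ +-identityʳ S₂ ⟨
  S₂ + 0            ≡⟨ cong (S₂ +_) (∑-zero (allVecs m)) ⟨
  _ ≡⟨ ∑-allVecs (λ x → 2 ^ zeros x * F x when (startsWith false x ∧ noTwoZerosFrom true x)) ⟨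
  _ ∎
  where
  open ≡-Reasoning
  S S₂ : ℕ
  S  = ∑ (allVecs m) (λ x → 2 ^ zeros x * F (false ∷ x) when (startsWith true x ∧ noTwoZerosFrom false x))
  S₂ = ∑ (allVecs m) (λ x → 2 ^ suc (zeros x) * F (false ∷ x) when noTwoZerosFrom false x)

-- Representing matrices are parametrised by their diagonals

infix 4 _==_
_==_ : Vec Bool n → Vec Bool n → Bool
[]      == []      = true
(a ∷ x) == (b ∷ y) = not (a xor b) ∧ (x == y)

==-refl : (x : Vec Bool n) → (x == x) ≡ true
==-refl []      = refl
==-refl (a ∷ x) rewrite xor-same a = ==-refl x

==⇒≡ : (x y : Vec Bool n) → (x == y) ≡ true → x ≡ y
==⇒≡ []          []          _   = refl
==⇒≡ (true ∷ x)  (true ∷ y)  x=y = cong (true ∷_) (==⇒≡ x y x=y)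
==⇒≡ (false ∷ x) (false ∷ y) x=y = cong (false ∷_) (==⇒≡ x y x=y)

==-disjoint : (r x y : Vec Bool n) → (x == y) ≡ false → ((r == x) ∧ (r == y)) ≡ false
==-disjoint r x y x≠y with r == x in r=x | r == y in r=y
... | true  | true rewrite sym (==⇒≡ r x r=x) = trans (sym r=y) x≠y
... | true  | false = refl
... | false | _     = refl

when-∧ : ∀ k a b → k when (a ∧ b) ≡ (k when b) when a
when-∧ k true  b = refl
when-∧ k false b = refl

when-∨ : ∀ k a b → (a ∧ b) ≡ false → k when (a ∨ b) ≡ (k when a) + (k when b)
when-∨ k true  false _ = sym (+-identityʳ k)
when-∨ k false b     _ = refl

∑-point : (c : Vec Bool n) (g : Vec Bool n → ℕ) → ∑ (allVecs n) (λ r → g r when (r == c)) ≡ g c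
∑-point []          g = +-identityʳ (g [])
∑-point {suc n} (false ∷ c) g = begin
  _ ≡⟨ ∑-allVecs (λ r → g r when (r == false ∷ c)) ⟩
  _ ≡⟨ cong₂ _+_ (∑-point c (g ∘ (false ∷_))) (∑-zero (allVecs n)) ⟩
  _ ≡⟨ +-identityʳ _ ⟩
  g (false ∷ c) ∎
  where open ≡-Reasoning
∑-point {suc n} (true ∷ c)  g = begin
  _ ≡⟨ ∑-allVecs (λ r → g r when (r == true ∷ c)) ⟩
  _ ≡⟨ cong (_+ ∑ (allVecs n) (λ r → g (true ∷ r) when (r == c))) (∑-zero (allVecs n)) ⟩
  _ ≡⟨ ∑-point c (g ∘ (true ∷_)) ⟩
  g (true ∷ c) ∎
  where open ≡-Reasoning

allFinᵇ : (Fin m → Bool) → Bool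
allFinᵇ {zero}  P = true
allFinᵇ {suc m} P = P zero ∧ allFinᵇ (P ∘ suc)

∑-rows : (P : Fin m → Vec Bool n → Bool) (f : Fin m → Bool → Vec Bool n) →
  (∀ i r → P i r ≡ ((r == f i false) ∨ (r == f i true))) → (∀ i → (f i false == f i true) ≡ false) →
  (W : Matrix m n → ℕ) →
  ∑ (allMatrices m n) (λ M → W M when allFinᵇ (λ i → P i (lookup M i)))
    ≡ ∑ (allVecs m) (λ d → W (tabulate (λ i → f i (lookup d i))))
∑-rows {zero}      P f P≡ distinct W = refl
∑-rows {suc m} {n} P f P≡ distinct W = begin
  _ ≡⟨ ∑-concatMap _ (λ r → map (r ∷_) (allMatrices m n)) (allVecs n) ⟩
  ∑ (allVecs n) (λ r → ∑ (map (r ∷_) (allMatrices m n)) (λ M → W M when allFinᵇ (λ i → P i (lookup M i))))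
    ≡⟨ ∑-cong (λ r → ∑-map _ (r ∷_) (allMatrices m n)) (allVecs n) ⟩
  ∑ (allVecs n) (λ r → ∑ (allMatrices m n) (λ M → W (r ∷ M) when (P zero r ∧ Rest M)))
    ≡⟨ ∑-cong (λ r → trans (∑-cong (λ M → when-∧ (W (r ∷ M)) (P zero r) (Rest M)) (allMatrices m n))
                           (∑-when _ (P zero r) (allMatrices m n))) (allVecs n) ⟩
  ∑ (allVecs n) (λ r → ∑ (allMatrices m n) (λ M → W (r ∷ M) when Rest M) when P zero r)
    ≡⟨ ∑-cong (λ r → cong₂ _when_ (∑-rows (P ∘ suc) (f ∘ suc) (P≡ ∘ suc) (distinct ∘ suc) (W ∘ (r ∷_)))
                                  (P≡ zero r))
              (allVecs n) ⟩
  ∑ (allVecs n) (λ r → Q r when ((r == f zero false) ∨ (r == f zero true)))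
    ≡⟨ ∑-cong (λ r → when-∨ (Q r) (r == f zero false) (r == f zero true) (==-disjoint r _ _ (distinct zero))) (allVecs n) ⟩
  ∑ (allVecs n) (λ r → (Q r when (r == f zero false)) + (Q r when (r == f zero true)))
    ≡⟨ ∑-+ _ _ (allVecs n) ⟩
  _ ≡⟨ cong₂ _+_ (∑-point (f zero false) Q) (∑-point (f zero true) Q) ⟩
  Q (f zero false) + Q (f zero true)
    ≡⟨ ∑-allVecs (λ d → W (tabulate (λ i → f i (lookup d i)))) ⟨
  _ ∎
  where
  open ≡-Reasoning
  Rest : Matrix m n → Bool
  Rest M = allFinᵇ (λ i → P (suc i) (lookup M i))
  Q : Vec Bool n → ℕ
  Q r = ∑ (allVecs m) (λ d → W (r ∷ tabulate (λ i → f (suc i) (lookup d i))))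

⇔ᵇ⇒≡ : ∀ {x y} → (x ≡ true → y ≡ true) → (y ≡ true → x ≡ true) → x ≡ y
⇔ᵇ⇒≡ {true}  {true}  _   _   = refl
⇔ᵇ⇒≡ {false} {false} _   _   = refl
⇔ᵇ⇒≡ {true}  {false} x⇒y _   = sym (x⇒y refl)
⇔ᵇ⇒≡ {false} {true}  _   y⇒x = y⇒x refl

allᵇ-tabulate : (F : X → Bool) (g : Fin m → X) → allᵇ F (toList (tabulate g)) ≡ allFinᵇ (F ∘ g)
allᵇ-tabulate {m = zero}  F g = refl
allᵇ-tabulate {m = suc m} F g = cong (F (g zero) ∧_) (allᵇ-tabulate F (g ∘ suc))

allFinᵇ-cong : {P Q : Fin m → Bool} → (∀ i → P i ≡ Q i) → allFinᵇ P ≡ allFinᵇ Q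
allFinᵇ-cong {zero}  P≗Q = refl
allFinᵇ-cong {suc m} P≗Q = cong₂ _∧_ (P≗Q zero) (allFinᵇ-cong (P≗Q ∘ suc))

allFinᵇ⇒ : (P : Fin m → Bool) → allFinᵇ P ≡ true → ∀ i → P i ≡ true
allFinᵇ⇒ P all-P zero    = proj₁ (∧≡true⇒ _ _ all-P)
allFinᵇ⇒ P all-P (suc i) = allFinᵇ⇒ (P ∘ suc) (proj₂ (∧≡true⇒ _ _ all-P)) i

allFinᵇ⇐ : (P : Fin m → Bool) → (∀ i → P i ≡ true) → allFinᵇ P ≡ true
allFinᵇ⇐ {zero}  P _     = refl
allFinᵇ⇐ {suc m} P all-P rewrite all-P zero = allFinᵇ⇐ (P ∘ suc) (all-P ∘ suc)

not-xor⇒≡ : ∀ a b → not (a xor b) ≡ true → a ≡ b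
not-xor⇒≡ true  true  _ = refl
not-xor⇒≡ false false _ = refl

module _ {n : ℕ} (G : Graph n) where

  rowWith : Fin n → Bool → Vec Bool n
  rowWith i b = tabulate (λ j → if ⌊ i ≟ᶠ j ⌋ then b else adj G i j)

  withDiagonal : Vec Bool n → Matrix n n
  withDiagonal d = tabulate (λ i → rowWith i (lookup d i))

  rowRepresents : Fin n → Vec Bool n → Bool
  rowRepresents i r = allFinᵇ (λ j → ⌊ i ≟ᶠ j ⌋ ∨ not (lookup r j xor adj G i j))

  represents≡ : (M : Matrix n n) → represents M G ≡ allFinᵇ (λ i → rowRepresents i (lookup M i))
  represents≡ M =
    trans (allᵇ-tabulate (λ i → allᵇ (λ j → ⌊ i ≟ᶠ j ⌋ ∨ not (entry M i j xor adj G i j)) (toList (allFin n))) id)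
    (allFinᵇ-cong (λ i → allᵇ-tabulate (λ j → ⌊ i ≟ᶠ j ⌋ ∨ not (entry M i j xor adj G i j)) id))

  lookup-rowWith : ∀ i b j → lookup (rowWith i b) j ≡ (if ⌊ i ≟ᶠ j ⌋ then b else adj G i j)
  lookup-rowWith i b = lookup∘tabulate (λ j → if ⌊ i ≟ᶠ j ⌋ then b else adj G i j)

  lookup-rowWith-diagonal : ∀ i b → lookup (rowWith i b) i ≡ b
  lookup-rowWith-diagonal i b rewrite lookup-rowWith i b i with i ≟ᶠ i
  ... | yes _   = refl
  ... | no  i≢i = ⊥-elim (i≢i refl)

  rowRepresents⇒ : ∀ i r → rowRepresents i r ≡ true → r ≡ rowWith i (lookup r i)
  rowRepresents⇒ i r ok = trans (sym (tabulate∘lookup r)) (tabulate-cong entry-ok)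
    where
    entry-ok : ∀ j → lookup r j ≡ (if ⌊ i ≟ᶠ j ⌋ then lookup r i else adj G i j)
    entry-ok j with allFinᵇ⇒ _ ok j
    ... | ok-j with i ≟ᶠ j
    ... | yes refl = refl
    ... | no  _    = not-xor⇒≡ _ _ ok-j

  rowRepresents-rowWith : ∀ i b → rowRepresents i (rowWith i b) ≡ true
  rowRepresents-rowWith i b = allFinᵇ⇐ _ entry-ok
    where
    entry-ok : ∀ j → (⌊ i ≟ᶠ j ⌋ ∨ not (lookup (rowWith i b) j xor adj G i j)) ≡ true
    entry-ok j rewrite lookup-rowWith i b j with i ≟ᶠ j
    ... | yes _ = refl
    ... | no  _ rewrite xor-same (adj G i j) = refl

  rowWith-distinct : ∀ i → (rowWith i false == rowWith i true) ≡ false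
  rowWith-distinct i with rowWith i false == rowWith i true in same
  ... | false = refl
  ... | true with trans (sym (lookup-rowWith-diagonal i false))
                  (trans (cong (λ r → lookup r i) (==⇒≡ (rowWith i false) (rowWith i true) same)) (lookup-rowWith-diagonal i true))
  ... | ()

  rowRepresents≡ : ∀ i r → rowRepresents i r ≡ ((r == rowWith i false) ∨ (r == rowWith i true))
  rowRepresents≡ i r = ⇔ᵇ⇒≡ to from
    where
    either : ∀ b → ((rowWith i b == rowWith i false) ∨ (rowWith i b == rowWith i true)) ≡ true
    either false rewrite ==-refl (rowWith i false) = refl
    either true  rewrite ==-refl (rowWith i true)  = ∨-zeroʳ _
    to : rowRepresents i r ≡ true → ((r == rowWith i false) ∨ (r == rowWith i true)) ≡ true
    to ok = subst (λ r → ((r == rowWith i false) ∨ (r == rowWith i true)) ≡ true)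
                  (sym (rowRepresents⇒ i r ok)) (either (lookup r i))
    from : ((r == rowWith i false) ∨ (r == rowWith i true)) ≡ true → rowRepresents i r ≡ true
    from r=row with r == rowWith i false in r=row₀
    ... | true  = subst (λ r → rowRepresents i r ≡ true) (sym (==⇒≡ r (rowWith i false) r=row₀))
                        (rowRepresents-rowWith i false)
    ... | false = subst (λ r → rowRepresents i r ≡ true) (sym (==⇒≡ r (rowWith i true) r=row)) (rowRepresents-rowWith i true)

  count-represents : (q : Matrix n n → Bool) →
    count (λ M → represents M G ∧ q M) (allMatrices n n) ≡ ∑ (allVecs n) (λ d → 1 when q (withDiagonal d))
  count-represents q = begin
    count (λ M → represents M G ∧ q M) (allMatrices n n)
      ≡⟨ count≡∑ _ (allMatrices n n) ⟩
    ∑ (allMatrices n n) (λ M → 1 when (represents M G ∧ q M))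
      ≡⟨ ∑-cong (λ M → trans (when-∧ 1 (represents M G) (q M)) (cong (1 when q M when_) (represents≡ M)))
                (allMatrices n n) ⟩
    ∑ (allMatrices n n) (λ M → 1 when q M when allFinᵇ (λ i → rowRepresents i (lookup M i)))
      ≡⟨ ∑-rows rowRepresents rowWith rowRepresents≡ rowWith-distinct (λ M → 1 when q M) ⟩
    ∑ (allVecs n) (λ d → 1 when q (withDiagonal d)) ∎
    where open ≡-Reasoning

pathEdge : Fin n → Fin n → Bool
pathEdge i j = (suc (toℕ i) ≡ᵇ toℕ j) ∨ (suc (toℕ j) ≡ᵇ toℕ i)

lookup-zeroVec : (j : Fin n) → lookup (zeroVec n) j ≡ false
lookup-zeroVec zero    = refl
lookup-zeroVec (suc j) = lookup-zeroVec j

lookup-e₀ : (j : Fin n) → lookup (e₀ n) j ≡ (0 ≡ᵇ toℕ j)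
lookup-e₀ zero    = refl
lookup-e₀ (suc j) = lookup-zeroVec j

lookup-tridiagonal : (ds : Vec Bool n) (i j : Fin n) →
  lookup (lookup (tridiagonal ds) i) j ≡ (if ⌊ i ≟ᶠ j ⌋ then lookup ds i else pathEdge i j)
lookup-tridiagonal (d ∷ ds) zero    zero    = refl
lookup-tridiagonal (d ∷ ds) zero    (suc j) = trans (lookup-e₀ j) (sym (∨-identityʳ _))
lookup-tridiagonal (d ∷ ds) (suc i) zero    =
  trans (cong (λ r → lookup r zero) (lookup-zipWith _∷_ i (e₀ _) (tridiagonal ds))) (lookup-e₀ i)
lookup-tridiagonal (d ∷ ds) (suc i) (suc j) =
  trans (cong (λ r → lookup r (suc j)) (lookup-zipWith _∷_ i (e₀ _) (tridiagonal ds))) (trans (lookup-tridiagonal ds i j) shift)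
  where
  shift : (if ⌊ i ≟ᶠ j ⌋ then lookup ds i else pathEdge i j)
        ≡ (if ⌊ suc i ≟ᶠ suc j ⌋ then lookup ds i else pathEdge i j)
  shift with i ≟ᶠ j
  ... | yes _ = refl
  ... | no  _ = refl

matrix-ext : (M M′ : Matrix m n) → (∀ i j → entry M i j ≡ entry M′ i j) → M ≡ M′
matrix-ext M M′ M≗M′ = trans (sym (tabulate∘lookup M)) (trans (tabulate-cong row≡) (tabulate∘lookup M′))
  where
  row≡ : ∀ i → lookup M i ≡ lookup M′ i
  row≡ i = trans (sym (tabulate∘lookup (lookup M i))) (trans (tabulate-cong (M≗M′ i)) (tabulate∘lookup (lookup M′ i)))

lowerRight-bordered : (d₀ : Bool) (v ds : Vec Bool n) → lowerRight (bordered d₀ v ds) ≡ tridiagonal ds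
lowerRight-bordered d₀ v ds = map-tail-zipWith v (tridiagonal ds)
  where
  map-tail-zipWith : (c : Vec Bool m) (R : Matrix m n) → Data.Vec.map tail (zipWith _∷_ c R) ≡ R
  map-tail-zipWith []      []      = refl
  map-tail-zipWith (x ∷ c) (r ∷ R) = cong (r ∷_) (map-tail-zipWith c R)

does-≟-true : ∀ b → does (b ≟ᵇ true) ≡ b
does-≟-true true  = refl
does-≟-true false = refl

module _ {k : ℕ} (G : Graph (suc (suc k))) (path : InducedPath G) where

  adj≡pathEdge : ∀ i j → adj G (suc i) (suc j) ≡ pathEdge i j
  adj≡pathEdge i j = trans (sym (does-≟-true _))
    (does-⇔ (path i j) (adj G (suc i) (suc j) ≟ᵇ true) ((suc (toℕ i) ≟ℕ toℕ j) ⊎-dec (suc (toℕ j) ≟ℕ toℕ i)))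

  lookup-adjVec : ∀ j → lookup (adjVec G) j ≡ adj G zero (suc j)
  lookup-adjVec j = trans (lookup-map j (λ i → adj G zero (suc i)) (allFin _)) (cong (λ i → adj G zero (suc i)) (lookup-allFin j))

  withDiagonal≡bordered : (d₀ : Bool) (ds : Vec Bool (suc k)) → withDiagonal G (d₀ ∷ ds) ≡ bordered d₀ (adjVec G) ds
  withDiagonal≡bordered d₀ ds = matrix-ext _ _ entries
    where
    entry-withDiagonal : ∀ i j →
      entry (withDiagonal G (d₀ ∷ ds)) i j ≡ (if ⌊ i ≟ᶠ j ⌋ then lookup (d₀ ∷ ds) i else adj G i j)
    entry-withDiagonal i j =
      trans (cong (λ r → lookup r j) (lookup∘tabulate (λ i → rowWith G i (lookup (d₀ ∷ ds) i)) i)) (lookup-rowWith G i _ j)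
    lookup-border : ∀ i → lookup (lookup (zipWith _∷_ (adjVec G) (tridiagonal ds)) i) zero ≡ adj G zero (suc i)
    lookup-border i = trans (cong (λ r → lookup r zero) (lookup-zipWith _∷_ i (adjVec G) (tridiagonal ds))) (lookup-adjVec i)
    entries : ∀ i j → entry (withDiagonal G (d₀ ∷ ds)) i j ≡ entry (bordered d₀ (adjVec G) ds) i j
    entries zero    zero    = entry-withDiagonal zero zero
    entries zero    (suc j) = trans (entry-withDiagonal zero (suc j)) (sym (lookup-adjVec j))
    entries (suc i) zero    = trans (entry-withDiagonal (suc i) zero) (trans (adj-sym G (suc i) zero) (sym (lookup-border i)))
    entries (suc i) (suc j) = trans (entry-withDiagonal (suc i) (suc j)) (trans off-diagonal
      (sym (trans (cong (λ r → lookup r (suc j)) (lookup-zipWith _∷_ i (adjVec G) (tridiagonal ds))) (lookup-tridiagonal ds i j))))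
      where
      off-diagonal : (if ⌊ suc i ≟ᶠ suc j ⌋ then lookup ds i else adj G (suc i) (suc j))
                   ≡ (if ⌊ i ≟ᶠ j ⌋ then lookup ds i else pathEdge i j)
      off-diagonal with i ≟ᶠ j
      ... | yes _ = refl
      ... | no  _ = adj≡pathEdge i j

∧-swap : ∀ x y z → x ∧ (y ∧ z) ≡ y ∧ (x ∧ z)
∧-swap = solve-∀ 𝔽₂

noTwoZerosFrom≡ : ∀ h (t : Vec Bool n) → noTwoZerosFrom h t ≡ last (h ∷ t) ∧ noTwoZeros (h ∷ t)
noTwoZerosFrom≡ h []       = sym (∧-identityʳ h)
noTwoZerosFrom≡ h (h′ ∷ t) rewrite noTwoZerosFrom≡ h′ t = ∧-swap (h ∨ h′) (last (h′ ∷ t)) (noTwoZeros (h′ ∷ t))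

inU≡ : (u : Vec Bool (suc n)) → inU u ≡ startsWith true u ∧ noTwoZerosFrom false u
inU≡ (true ∷ t)  = sym (noTwoZerosFrom≡ true t)
inU≡ (false ∷ t) = refl

*-when-1 : ∀ j b → j * (1 when b) ≡ j when b
*-when-1 j true  = *-identityʳ j
*-when-1 j false = *-zeroʳ j

∑-singular : (v : Vec Bool (suc n)) (p : Bool → Bool) →
  ∑ (allVecs (suc n)) (λ ds → 1 when (singular ds ∧ p (dot (kernelVec ds) v)))
    ≡ ∑ (allVecs (suc n)) (λ x → 2 ^ zeros x when (inU x ∧ p (dot x v)))
∑-singular {n} v p = begin
  _ ≡⟨ ∑-cong (λ ds → when-∧ 1 (singular ds) _) (allVecs (suc n)) ⟩
  _ ≡⟨ ∑-shoot (suc n) false true (λ x → 1 when p (dot x v)) refl ⟩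
  _ ≡⟨ ∑-cong weight (allVecs (suc n)) ⟩
  _ ∎
  where
  open ≡-Reasoning
  weight : ∀ x → 2 ^ zeros x * (1 when p (dot x v)) when (startsWith true x ∧ noTwoZerosFrom false x)
               ≡ 2 ^ zeros x when (inU x ∧ p (dot x v))
  weight x = begin
    _ ≡⟨ cong (_when (startsWith true x ∧ noTwoZerosFrom false x)) (*-when-1 (2 ^ zeros x) (p (dot x v))) ⟩
    _ ≡⟨ when-∧ (2 ^ zeros x) _ (p (dot x v)) ⟨
    _ ≡⟨ cong (λ b → 2 ^ zeros x when (b ∧ p (dot x v))) (inU≡ x) ⟨
    _ ∎

when-excluded-middle : ∀ j a b c → (j when (a ∧ (b ∧ c))) + (j when (a ∧ (b ∧ not c))) ≡ j when (a ∧ b)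
when-excluded-middle j true  true  true  = +-identityʳ j
when-excluded-middle j true  true  false = refl
when-excluded-middle j true  false c     = refl
when-excluded-middle j false b     c     = refl

module _ {k : ℕ} (G : Graph (suc (suc k))) (path : InducedPath G) where

  private
    v : Vec Bool (suc k)
    v = adjVec G

    BorderCount : ℕ → Bool → ℕ
    BorderCount r d₀ =
      ∑ (allVecs (suc k)) (λ ds → 1 when ((rank (bordered d₀ v ds) ≡ᵇ r) ∧ (rank (tridiagonal ds) ≡ᵇ k)))

  count-by-border : (r : ℕ) →
    count (λ M → represents M G ∧ (rank M ≡ᵇ r) ∧ (rank (lowerRight M) ≡ᵇ k)) (allMatrices (suc (suc k)) (suc (suc k)))
      ≡ BorderCount r false + BorderCount r true
  count-by-border r =
    trans (count-represents G q) (trans (∑-allVecs (λ d → 1 when q (withDiagonal G d)))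
      (cong₂ _+_ (∑-cong (by-border false) (allVecs (suc k))) (∑-cong (by-border true) (allVecs (suc k)))))
    where
    q : Matrix (suc (suc k)) (suc (suc k)) → Bool
    q M = (rank M ≡ᵇ r) ∧ (rank (lowerRight M) ≡ᵇ k)
    by-border : ∀ d₀ ds → 1 when q (withDiagonal G (d₀ ∷ ds))
                         ≡ 1 when ((rank (bordered d₀ v ds) ≡ᵇ r) ∧ (rank (tridiagonal ds) ≡ᵇ k))
    by-border d₀ ds = trans (cong (λ M → 1 when q M) (withDiagonal≡bordered G path d₀ ds))
      (cong (λ L → 1 when ((rank (bordered d₀ v ds) ≡ᵇ r) ∧ (rank L ≡ᵇ k))) (lowerRight-bordered d₀ v ds))

  A-formula : A G ≡ sum (map (λ u → 2 ^ (zeros u + 1)) (filter (λ u → (inU u ∧ dot u v) ≟ᵇ true) (allVecs (suc k))))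
  A-formula = begin
    A G
      ≡⟨ count-by-border (suc (suc k)) ⟩
    BorderCount (suc (suc k)) false + BorderCount (suc (suc k)) true
      ≡⟨ cong₂ _+_ (full-rank false) (full-rank true) ⟩
    S + S
      ≡⟨ cong (S +_) (+-identityʳ S) ⟨
    2 * S
      ≡⟨ cong (2 *_) (∑-singular v id) ⟩
    2 * ∑ (allVecs (suc k)) (λ x → 2 ^ zeros x when (inU x ∧ dot x v))
      ≡⟨ ∑-*ˡ 2 _ (allVecs (suc k)) ⟨
    ∑ (allVecs (suc k)) (λ x → 2 * (2 ^ zeros x when (inU x ∧ dot x v)))
      ≡⟨ ∑-cong (λ x → trans (sym (when-*ˡ 2 (2 ^ zeros x) (inU x ∧ dot x v)))
                             (cong (λ e → 2 ^ e when (inU x ∧ dot x v)) (+-comm 1 (zeros x))))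
                (allVecs (suc k)) ⟩
    ∑ (allVecs (suc k)) (λ x → 2 ^ (zeros x + 1) when (inU x ∧ dot x v))
      ≡⟨ sum-filter≡∑ (λ u → inU u ∧ dot u v) (λ u → 2 ^ (zeros u + 1)) (allVecs (suc k)) ⟨
    _ ∎
    where
    open ≡-Reasoning
    S : ℕ
    S = ∑ (allVecs (suc k)) (λ ds → 1 when (singular ds ∧ dot (kernelVec ds) v))
    full-rank : ∀ d₀ → BorderCount (suc (suc k)) d₀ ≡ S
    full-rank d₀ = ∑-cong (λ ds → cong (1 when_) (full-rank-condition d₀ v ds)) (allVecs (suc k))

  B-formula : B G ≡ sum (map (λ u → 2 ^ zeros u) (filter (λ u → (inU u ∧ not (dot u v)) ≟ᵇ true) (allVecs (suc k))))
  B-formula = begin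
    B G
      ≡⟨ count-by-border (suc k) ⟩
    BorderCount (suc k) false + BorderCount (suc k) true
      ≡⟨ cong₂ _+_ (corank-one false) (corank-one true) ⟩
    _ ≡⟨ ∑-+ _ _ (allVecs (suc k)) ⟨
    _ ≡⟨ ∑-cong (λ ds → when-excluded-middle 1 (singular ds) (not (dot (kernelVec ds) v)) (dot (shoot false false ds v) v))
                (allVecs (suc k)) ⟩
    ∑ (allVecs (suc k)) (λ ds → 1 when (singular ds ∧ not (dot (kernelVec ds) v)))
      ≡⟨ ∑-singular v not ⟩
    ∑ (allVecs (suc k)) (λ x → 2 ^ zeros x when (inU x ∧ not (dot x v)))
      ≡⟨ sum-filter≡∑ (λ u → inU u ∧ not (dot u v)) (λ u → 2 ^ zeros u) (allVecs (suc k)) ⟨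
    _ ∎
    where
    open ≡-Reasoning
    corank-one : ∀ d₀ → BorderCount (suc k) d₀
      ≡ ∑ (allVecs (suc k))
          (λ ds → 1 when (singular ds ∧ (not (dot (kernelVec ds) v) ∧ (d₀ xor dot (shoot false false ds v) v))))
    corank-one d₀ = ∑-cong (λ ds → cong (1 when_) (corank-one-condition d₀ v ds)) (allVecs (suc k))

mainTheorem7 : (k : ℕ) (G : Graph (suc (suc k))) →
    Connected G → InducedPath G →
    (A G ≡ sum (map (λ u → 2 ^ (zeros u + 1))
                    (filter (λ u → (inU u ∧ dot u (adjVec G)) ≟ᵇ true) (allVecs (suc k)))))
    × (B G ≡ sum (map (λ u → 2 ^ zeros u)
                    (filter (λ u → (inU u ∧ (Data.Bool.not (dot u (adjVec G)))) ≟ᵇ true) (allVecs (suc k)))))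
mainTheorem7 k G _ path = A-formula G path , B-formula G path
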